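{- A pentagonal tiling of an oriented compact connected surface without boundary is the pentagonal subdivision $T(5)$ of some tiling $T$ if and only if all its tiles are non-degenerate and it is possible to label some vertices by $\bullet$ and some other vertices by $\circ$ such that the vertices of each tile, read along the orientation of the surface, have the pattern $\bullet,\ 3,\ \circ,\ 3,\ 3$, where $3$ stands for an unlabelled vertex of degree $3$.
   Context: A tiling of a compact connected surface without boundary is a graph embedded in the surface such that the complementary regions (tiles) are open disks; tilings are edge-to-edge, every vertex has degree at least $3$, every tile has at least $3$ edges, and tiles may be degenerate (boundary not a simple closed curve); a polygon is non-degenerate if its boundary is a simple closed curve. A pentagonal tiling has $5$ edges along each tile boundary. Pentagonal subdivision: let $T$ be a tiling of an oriented surface. Divide each edge of $T$ into three segments by two dividing points. For a tile $t$ and an edge $e$ on its boundary, traverse $e$ in the direction induced by the orientation of $\partial t$ and call the dividing point met first the first dividing point of $e$ from the viewpoint of $t$ (from the viewpoint of the tile on the other side, the roles of the two points are swapped). Choose a center point in each tile $t$ and join it to the first dividing point (from the viewpoint of $t$) of each edge of $t$, doing this for every pair $(t,e)$. The resulting pentagonal tiling is the pentagonal subdivision $T(5)$; its vertices are the vertices of $T$, the centers of tiles of $T$, and the dividing points (of degree $3$). -}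

module Defs where

open import Data.Nat using (ℕ; zero; suc; _<_; _≤_)
open import Data.Fin using (Fin; zero; suc)
open import Data.Fin.Permutation using (Permutation′; _⟨$⟩ʳ_; _⟨$⟩ˡ_)
open import Data.Product using (Σ; ∃; ∃-syntax; _×_; _,_)
open import Data.Maybe using (Maybe; just; nothing)
open import Relation.Binary.PropositionalEquality using (_≡_; _≢_)
open import Relation.Nullary using (¬_)
open import Function.Bundles using (_↔_; Inverse)

iter : {A : Set} → ℕ → (A → A) → A → A
iter zero    f x = x
iter (suc k) f x = f (iter k f x)

OrbitSize : {A : Set} → (A → A) → A → ℕ → Set
OrbitSize f x k = (0 < k) × (iter k f x ≡ x) × (∀ j → 0 < j → j < k → iter j f x ≢ x)

-- Combinatorial maps (rotation systems) = cellularly embedded graphs on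
-- oriented compact surfaces without boundary.
--   darts   : Fin n   (half-edges)
--   α       : edge involution (the other half of the same edge)
--   σ       : rotation of darts around their vertex, along the orientation
--   φ = σ ∘ α : face permutation; tiles = φ-orbits, read along φ.
-- The vertex of a dart is its σ-orbit (the dart starts at that vertex).
record Map : Set where
  field
    n : ℕ
    α σ : Permutation′ n

  a : Fin n → Fin n
  a x = α ⟨$⟩ʳ x

  s : Fin n → Fin n
  s x = σ ⟨$⟩ʳ x

  φ : Fin n → Fin n
  φ x = s (a x)

  φ⁻¹ : Fin n → Fin n
  φ⁻¹ x = α ⟨$⟩ˡ (σ ⟨$⟩ˡ x)

  SameVertex : Fin n → Fin n → Set
  SameVertex x y = ∃[ k ] (iter k s x ≡ y)

  data Reach : Fin n → Fin n → Set where
    here : ∀ {x} → Reach x x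
    viaα : ∀ {x y} → Reach (a x) y → Reach x y
    viaσ : ∀ {x y} → Reach (s x) y → Reach x y

open Map public

record IsTiling (T : Map) : Set where
  field
    α-invol   : ∀ x → a T (a T x) ≡ x
    α-nofix   : ∀ x → a T x ≢ x
    inhabited : Fin (n T)
    connected : ∀ x y → Reach T x y
    degree≥3  : ∀ x k → OrbitSize (s T) x k → 3 ≤ k
    tile≥3    : ∀ x k → OrbitSize (φ T) x k → 3 ≤ k

Pentagonal : Map → Set
Pentagonal M = ∀ x → OrbitSize (φ M) x 5

NonDegenerate : Map → Set
NonDegenerate M = ∀ x k → OrbitSize (φ M) x k →
  ∀ i j → i < j → j < k → ¬ SameVertex M (iter i (φ M) x) (iter j (φ M) x)

-- Pentagonal subdivision T(5), darts Fin n × Fin 5.  For a dart d of T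
-- from u to w along edge e, with p_u, p_w the dividing points of e near
-- u, w, and c the center of the tile of d (its φ-orbit):
--   (d,0) : u  → p_u        (d,1) : p_u → p_w       (d,2) : p_w → w
--   (d,3) : c  → p_u        (d,4) : p_u → c
-- p_u is the first dividing point of e from the viewpoint of the tile of d
-- (the tile traverses d from u to w).
module _ (T : Map) where
  sub-α : Fin (n T) × Fin 5 → Fin (n T) × Fin 5
  sub-α (d , zero)                         = (a T d , suc (suc zero))
  sub-α (d , suc zero)                     = (a T d , suc zero)
  sub-α (d , suc (suc zero))               = (a T d , zero)
  sub-α (d , suc (suc (suc zero)))         = (d , suc (suc (suc (suc zero))))
  sub-α (d , suc (suc (suc (suc zero))))   = (d , suc (suc (suc zero)))

  sub-σ : Fin (n T) × Fin 5 → Fin (n T) × Fin 5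
  sub-σ (d , zero)                         = (s T d , zero)
  sub-σ (d , suc zero)                     = (a T d , suc (suc zero))
  sub-σ (d , suc (suc zero))               = (a T d , suc (suc (suc (suc zero))))
  sub-σ (d , suc (suc (suc zero)))         = (φ⁻¹ T d , suc (suc (suc zero)))
  sub-σ (d , suc (suc (suc (suc zero))))   = (d , suc zero)

IsPentSubdivision : Map → Set
IsPentSubdivision M =
  Σ Map λ T → IsTiling T ×
    Σ (Fin (n M) ↔ (Fin (n T) × Fin 5)) λ f →
      (∀ x → Inverse.to f (a M x) ≡ sub-α T (Inverse.to f x)) ×
      (∀ x → Inverse.to f (s M x) ≡ sub-σ T (Inverse.to f x))

data Label : Set where
  ● ○ : Label

Three : (M : Map) → (Fin (n M) → Maybe Label) → Fin (n M) → Set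
Three M ℓ x = (ℓ x ≡ nothing) × OrbitSize (s M) x 3

Pattern : (M : Map) → (Fin (n M) → Maybe Label) → Fin (n M) → Set
Pattern M ℓ x =
  (ℓ x ≡ just ●) × Three M ℓ (iter 1 (φ M) x) × (ℓ (iter 2 (φ M) x) ≡ just ○) ×
  Three M ℓ (iter 3 (φ M) x) × Three M ℓ (iter 4 (φ M) x)

GoodLabelling : (M : Map) → (Fin (n M) → Maybe Label) → Set
GoodLabelling M ℓ = (∀ x → ℓ (s M x) ≡ ℓ x) × (∀ x → ∃[ k ] Pattern M ℓ (iter k (φ M) x))

-- (⇒) Label a dart (d , c) of T(5) ● in slot c = 0 (leaving an original vertex) and ○ in
-- slot 3 (leaving a centre); each tile then reads the pattern from its slot-0 dart.  A coarse
-- vertex "kind" (original, centre, or a named dividing point), constant on vertices and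
-- different for a dart and its next two successors, separates the corners of a 5-periodic
-- tile, giving non-degeneracy.
--
-- (⇐) The labels of a dart and of its successor fix its position 0..4 in its tile, read
-- from the tile's unique ●-dart.  The ●-darts are the darts of T (s restricted, an explicit
-- "partner" as edge involution); (start, position) is the bijection M ≅ T(5), and a few
-- local identities show that it intertwines a and s with T(5).
module Submission where

open import Defs
open import Data.Empty using (⊥-elim)
open import Data.Fin using (Fin; zero; suc; toℕ; inject₁)
open import Data.Fin.Permutation using (_⟨$⟩ˡ_; inverseˡ; inverseʳ)
open import Data.Fin.Properties using (pigeonhole; toℕ-inject₁)
open import Data.Maybe using (Maybe; just; nothing)
open import Data.Nat using (ℕ; zero; suc; _+_; _<_; z≤n; s≤s)
open import Data.Nat.Properties using (<-cmp; ≤-trans; +-comm; +-suc; m≤n+m; n<1+n; m≤n⇒∃[o]m+o≡n)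
open import Data.Product using (Σ; ∃-syntax; _×_; _,_; proj₁; proj₂)
open import Function.Bundles using (_⇔_; mk⇔; _↔_; Inverse; mk↔ₛ′)
open import Relation.Binary.Definitions using (tri<; tri≈; tri>)
open import Relation.Binary.PropositionalEquality
  using (_≡_; _≢_; refl; sym; trans; cong; cong₂; subst; subst₂; module ≡-Reasoning)
open import Relation.Nullary using (Dec; yes; no)

pattern c₀ = zero
pattern c₁ = suc zero
pattern c₂ = suc (suc zero)
pattern c₃ = suc (suc (suc zero))
pattern c₄ = suc (suc (suc (suc zero)))

iter-+ : {A : Set} (f : A → A) (j k : ℕ) (x : A) → iter (j + k) f x ≡ iter j f (iter k f x)
iter-+ f zero    k x = refl
iter-+ f (suc j) k x = cong f (iter-+ f j k x)

iter-suc-inner : {A : Set} (f : A → A) (j : ℕ) (x : A) → iter (suc j) f x ≡ iter j f (f x)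
iter-suc-inner f zero    x = refl
iter-suc-inner f (suc j) x = cong f (iter-suc-inner f j x)

iter-conj : {A B : Set} (h : A → B) {F : A → A} {G : B → B} →
  (∀ x → h (F x) ≡ G (h x)) → ∀ k x → h (iter k F x) ≡ iter k G (h x)
iter-conj h e zero    x = refl
iter-conj h {G = G} e (suc k) x = trans (e _) (cong G (iter-conj h e k x))

iter-invariant : {A B : Set} (g : A → B) {f : A → A} →
  (∀ x → g (f x) ≡ g x) → ∀ k x → g (iter k f x) ≡ g x
iter-invariant g e zero    x = refl
iter-invariant g e (suc k) x = trans (e _) (iter-invariant g e k x)

iter-injective : {A : Set} (f g : A → A) → (∀ x → g (f x) ≡ x) →
  ∀ j {y z} → iter j f y ≡ iter j f z → y ≡ z
iter-injective f g gf zero    e = e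
iter-injective f g gf (suc j) e = iter-injective f g gf j (trans (sym (gf _)) (trans (cong g e) (gf _)))

iter-cancel : {A : Set} (f g : A → A) → (∀ x → f (g x) ≡ x) →
  ∀ j x → iter j f (iter j g x) ≡ x
iter-cancel f g fg zero    x = refl
iter-cancel f g fg (suc j) x =
  trans (iter-suc-inner f j _) (trans (cong (iter j f) (fg _)) (iter-cancel f g fg j x))

orbitSize-unique : {A : Set} {f : A → A} {x : A} {k m : ℕ} →
  OrbitSize f x k → OrbitSize f x m → k ≡ m
orbitSize-unique {k = k} {m} (0<k , fᵏ , minₖ) (0<m , fᵐ , minₘ) with <-cmp k m
... | tri< k<m _ _ = ⊥-elim (minₘ k 0<k k<m fᵏ)
... | tri≈ _ k≡m _ = k≡m
... | tri> _ _ m<k = ⊥-elim (minₖ m 0<m m<k fᵐ)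

fixed-orbitSize : {A : Set} {f : A → A} {x : A} → f x ≡ x → OrbitSize f x 1
fixed-orbitSize e = s≤s z≤n , e , λ { zero () _ ; (suc j) _ (s≤s ()) }

module _ {A B : Set} (h : A → B) {F : A → A} {G : B → B}
         (h-injective : ∀ {x y} → h x ≡ h y → x ≡ y) (h∘F : ∀ x → h (F x) ≡ G (h x)) where

  orbitSize-to : ∀ {x k} → OrbitSize F x k → OrbitSize G (h x) k
  orbitSize-to {x} {k} (0<k , fᵏ , min) =
    0<k , trans (sym (iter-conj h h∘F k x)) (cong h fᵏ) ,
    λ j 0<j j<k e → min j 0<j j<k (h-injective (trans (iter-conj h h∘F j x) e))

  orbitSize-from : ∀ {x k} → OrbitSize G (h x) k → OrbitSize F x k
  orbitSize-from {x} {k} (0<k , gᵏ , min) =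
    0<k , h-injective (trans (iter-conj h h∘F k x) gᵏ) ,
    λ j 0<j j<k e → min j 0<j j<k (trans (sym (iter-conj h h∘F j x)) (cong h e))

orbitSize-inverse : {A : Set} (f g : A → A) → (∀ x → f (g x) ≡ x) → (∀ x → g (f x) ≡ x) →
  ∀ {x k} → OrbitSize f x k → OrbitSize g x k
orbitSize-inverse f g fg gf {x} {k} (0<k , fᵏ , min) =
  0<k , trans (cong (iter k g) (sym fᵏ)) (iter-cancel g f gf k x) ,
  λ j 0<j j<k e → min j 0<j j<k (trans (cong (iter j f) (sym e)) (iter-cancel f g fg j x))

-- On a finite set the inverse of a permutation p is an iterate of p: by pigeonhole two of
-- x, p x, …, pⁿ x coincide, and cancelling gives p^(t+1) x = x.
inverse-is-iterate : ∀ {n} (p q : Fin n → Fin n) → (∀ x → q (p x) ≡ x) →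
  ∀ x → ∃[ t ] iter t p x ≡ q x
inverse-is-iterate {n} p q qp x
  with pigeonhole (n<1+n n) (λ (i : Fin (suc n)) → iter (toℕ i) p x)
... | i , j , i<j , pⁱ≡pʲ with m≤n⇒∃[o]m+o≡n i<j
... | t , i+t+1≡j = t , trans (sym (qp _)) (cong q (sym returns))
  where
  open ≡-Reasoning
  returns : x ≡ iter (suc t) p x
  returns = iter-injective p q qp (toℕ i) (begin
    iter (toℕ i) p x                     ≡⟨ pⁱ≡pʲ ⟩
    iter (toℕ j) p x                     ≡⟨ cong (λ m → iter m p x) (sym i+t+1≡j) ⟩
    iter (suc (toℕ i + t)) p x           ≡⟨ cong (λ m → iter m p x) (sym (+-suc (toℕ i) t)) ⟩
    iter (toℕ i + suc t) p x             ≡⟨ iter-+ p (toℕ i) (suc t) x ⟩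
    iter (toℕ i) p (iter (suc t) p x)    ∎)

-- On an orbit of period 5, a key that differs between every point and its next two
-- successors separates all five points (distances 3 and 4 are distances 2 and 1 backwards).
module _ {A X : Set} (f : A → A) (key : A → X) (period : ∀ x → iter 5 f x ≡ x)
         (apart₁ : ∀ x → key x ≢ key (f x)) (apart₂ : ∀ x → key x ≢ key (f (f x))) where

  private
    apart : ∀ d x → 0 < d → d < 5 → key x ≢ key (iter d f x)
    apart 1 x _ _ = apart₁ x
    apart 2 x _ _ = apart₂ x
    apart 3 x _ _ e = apart₂ (iter 3 f x) (trans (sym e) (cong key (sym (period x))))
    apart 4 x _ _ e = apart₁ (iter 4 f x) (trans (sym e) (cong key (sym (period x))))
    apart (suc (suc (suc (suc (suc _))))) x _ (s≤s (s≤s (s≤s (s≤s (s≤s ())))))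

  separated-on-period5 : ∀ x i j → i < j → j < 5 → key (iter i f x) ≢ key (iter j f x)
  separated-on-period5 x i j i<j j<5 with m≤n⇒∃[o]m+o≡n i<j
  ... | d , refl = λ e → apart (suc d) (iter i f x) (s≤s z≤n)
                           (≤-trans (s≤s (s≤s (m≤n+m d i))) j<5) (trans e (cong key shift))
    where
    shift : iter (suc i + d) f x ≡ iter (suc d) f (iter i f x)
    shift = trans (cong (λ m → iter (suc m) f x) (+-comm i d)) (iter-+ f (suc d) i x)

module MapFacts (M : Map) where

  φ-φ⁻¹ : ∀ x → φ M (φ⁻¹ M x) ≡ x
  φ-φ⁻¹ x = trans (cong (s M) (inverseʳ (α M))) (inverseʳ (σ M))

  φ⁻¹-φ : ∀ x → φ⁻¹ M (φ M x) ≡ x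
  φ⁻¹-φ x = trans (cong (α M ⟨$⟩ˡ_) (inverseˡ (σ M))) (inverseˡ (α M))

  s-s⁻¹ : ∀ x → s M (σ M ⟨$⟩ˡ x) ≡ x
  s-s⁻¹ x = inverseʳ (σ M)

  s⁻¹-s : ∀ x → σ M ⟨$⟩ˡ (s M x) ≡ x
  s⁻¹-s x = inverseˡ (σ M)

  s-injective : ∀ {x y} → s M x ≡ s M y → x ≡ y
  s-injective {x} {y} e = trans (sym (s⁻¹-s x)) (trans (cong (σ M ⟨$⟩ˡ_) e) (s⁻¹-s y))

  φ-injective : ∀ {x y} → φ M x ≡ φ M y → x ≡ y
  φ-injective {x} {y} e = trans (sym (φ⁻¹-φ x)) (trans (cong (φ⁻¹ M) e) (φ⁻¹-φ y))

  reach-trans : ∀ {x y z} → Reach M x y → Reach M y z → Reach M x z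
  reach-trans here     q = q
  reach-trans (viaα r) q = viaα (reach-trans r q)
  reach-trans (viaσ r) q = viaσ (reach-trans r q)

  reach-iter : (f : Fin (n M) → Fin (n M)) → (∀ x → Reach M x (f x)) →
    ∀ t x → Reach M x (iter t f x)
  reach-iter f step zero    x = here
  reach-iter f step (suc t) x = reach-trans (reach-iter f step t x) (step _)

  reach-α⁻¹ : ∀ x → Reach M x (α M ⟨$⟩ˡ x)
  reach-α⁻¹ x with inverse-is-iterate (a M) (α M ⟨$⟩ˡ_) (λ _ → inverseˡ (α M)) x
  ... | t , aᵗ≡a⁻¹ = subst (Reach M x) aᵗ≡a⁻¹ (reach-iter (a M) (λ _ → viaα here) t x)

  reach-σ⁻¹ : ∀ x → Reach M x (σ M ⟨$⟩ˡ x)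
  reach-σ⁻¹ x with inverse-is-iterate (s M) (σ M ⟨$⟩ˡ_) s⁻¹-s x
  ... | t , sᵗ≡s⁻¹ = subst (Reach M x) sᵗ≡s⁻¹ (reach-iter (s M) (λ _ → viaσ here) t x)

module TilingFacts {T : Map} (tT : IsTiling T) where
  open IsTiling tT

  σ-no-fixed : ∀ x → s T x ≢ x
  σ-no-fixed x e with degree≥3 x 1 (fixed-orbitSize e)
  ... | s≤s ()

  φ-no-fixed : ∀ x → φ T x ≢ x
  φ-no-fixed x e with tile≥3 x 1 (fixed-orbitSize e)
  ... | s≤s ()

record Enumeration {n : ℕ} (B : Fin n → Set) : Set where
  field
    size          : ℕ
    element       : Fin size → Fin n
    element∈      : ∀ i → B (element i)
    index         : ∀ x → B x → Fin size
    element-index : ∀ x (b : B x) → element (index x b) ≡ x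
    index-element : ∀ i (b : B (element i)) → index (element i) b ≡ i

  element-injective : ∀ {i j} → element i ≡ element j → i ≡ j
  element-injective {i} {j} e =
    trans (sym (index-element i _)) (trans (index-along e) (index-element j (element∈ j)))
    where
    index-along : ∀ {x y} (e : x ≡ y) {b : B y} → index x (subst B (sym e) b) ≡ index y b
    index-along refl = refl

enumerate : ∀ n (B : Fin n → Set) → (∀ x → Dec (B x)) → Enumeration B
enumerate zero    B B? = record
  { size = 0 ; element = λ () ; element∈ = λ () ; index = λ ()
  ; element-index = λ () ; index-element = λ () }
enumerate (suc n) B B? with enumerate n (λ x → B (suc x)) (λ x → B? (suc x)) | B? zero
... | E | yes b₀ = record
  { size = suc size ; element = element′ ; element∈ = element∈′ ; index = index′
  ; element-index = element-index′ ; index-element = index-element′ }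
  where
  open Enumeration E
  element′ : Fin (suc size) → Fin (suc n)
  element′ zero    = zero
  element′ (suc i) = suc (element i)
  element∈′ : ∀ i → B (element′ i)
  element∈′ zero    = b₀
  element∈′ (suc i) = element∈ i
  index′ : ∀ x → B x → Fin (suc size)
  index′ zero    _ = zero
  index′ (suc x) b = suc (index x b)
  element-index′ : ∀ x b → element′ (index′ x b) ≡ x
  element-index′ zero    _ = refl
  element-index′ (suc x) b = cong suc (element-index x b)
  index-element′ : ∀ i b → index′ (element′ i) b ≡ i
  index-element′ zero    _ = refl
  index-element′ (suc i) b = cong suc (index-element i b)
... | E | no ¬b₀ = record
  { size = size ; element = λ i → suc (element i) ; element∈ = element∈ ; index = index′
  ; element-index = element-index′ ; index-element = index-element }
  where
  open Enumeration E
  index′ : ∀ x → B x → Fin size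
  index′ zero    b = ⊥-elim (¬b₀ b)
  index′ (suc x) b = index x b
  element-index′ : ∀ x b → suc (element (index′ x b)) ≡ x
  element-index′ zero    b = ⊥-elim (¬b₀ b)
  element-index′ (suc x) b = cong suc (element-index x b)

module Subdivision (T : Map) where
  open MapFacts T

  sub-φ : Fin (n T) × Fin 5 → Fin (n T) × Fin 5
  sub-φ p = sub-σ T (sub-α T p)

  next-slot : Fin 5 → Fin 5
  next-slot c₀ = c₄
  next-slot c₁ = c₂
  next-slot c₂ = c₀
  next-slot c₃ = c₁
  next-slot c₄ = c₃

  sub-φ-slot : ∀ p → proj₂ (sub-φ p) ≡ next-slot (proj₂ p)
  sub-φ-slot (d , c₀) = refl
  sub-φ-slot (d , c₁) = refl
  sub-φ-slot (d , c₂) = refl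
  sub-φ-slot (d , c₃) = refl
  sub-φ-slot (d , c₄) = refl

  steps-to-c₀ : Fin 5 → ℕ
  steps-to-c₀ c₀ = 0
  steps-to-c₀ c₁ = 2
  steps-to-c₀ c₂ = 1
  steps-to-c₀ c₃ = 3
  steps-to-c₀ c₄ = 4

  steps-to-c₀-spec : ∀ c → iter (steps-to-c₀ c) next-slot c ≡ c₀
  steps-to-c₀-spec c₀ = refl
  steps-to-c₀-spec c₁ = refl
  steps-to-c₀-spec c₂ = refl
  steps-to-c₀-spec c₃ = refl
  steps-to-c₀-spec c₄ = refl

  -- Slot 0 darts leave original vertices (●), slot 3 darts leave centres (○); the other
  -- slots leave dividing points.  This labelling is constant around each vertex.
  slot-label : Fin 5 → Maybe Label
  slot-label c₀ = just ●
  slot-label c₁ = nothing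
  slot-label c₂ = nothing
  slot-label c₃ = just ○
  slot-label c₄ = nothing

  slot-label-σ : ∀ p → slot-label (proj₂ (sub-σ T p)) ≡ slot-label (proj₂ p)
  slot-label-σ (d , c₀) = refl
  slot-label-σ (d , c₁) = refl
  slot-label-σ (d , c₂) = refl
  slot-label-σ (d , c₃) = refl
  slot-label-σ (d , c₄) = refl

  data Dividing : Fin 5 → Set where
    dividing₁ : Dividing c₁
    dividing₂ : Dividing c₂
    dividing₄ : Dividing c₄

  dividing-unlabelled : ∀ {c} → Dividing c → slot-label c ≡ nothing
  dividing-unlabelled dividing₁ = refl
  dividing-unlabelled dividing₂ = refl
  dividing-unlabelled dividing₄ = refl

  slots-differ : ∀ {p q : Fin (n T) × Fin 5} → proj₂ p ≢ proj₂ q → p ≢ q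
  slots-differ c≢c′ e = c≢c′ (cong proj₂ e)

  original-degree : ∀ {d k} → OrbitSize (s T) d k → OrbitSize (sub-σ T) (d , c₀) k
  original-degree = orbitSize-to (_, c₀) (λ { refl → refl }) (λ _ → refl)

  -- Around the centre of a tile of T the darts follow the tile backwards.
  centre-degree : ∀ {d k} → OrbitSize (φ T) d k → OrbitSize (sub-σ T) (d , c₃) k
  centre-degree os =
    orbitSize-to (_, c₃) (λ { refl → refl }) (λ _ → refl)
      (orbitSize-inverse (φ T) (φ⁻¹ T) φ-φ⁻¹ φ⁻¹-φ os)

  sub-α-connected : ∀ p → Reach T (proj₁ p) (proj₁ (sub-α T p))
  sub-α-connected (d , c₀) = viaα here
  sub-α-connected (d , c₁) = viaα here
  sub-α-connected (d , c₂) = viaα here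
  sub-α-connected (d , c₃) = here
  sub-α-connected (d , c₄) = here

  sub-σ-connected : ∀ p → Reach T (proj₁ p) (proj₁ (sub-σ T p))
  sub-σ-connected (d , c₀) = viaσ here
  sub-σ-connected (d , c₁) = viaα here
  sub-σ-connected (d , c₂) = viaα here
  sub-σ-connected (d , c₃) = reach-trans (reach-σ⁻¹ d) (reach-α⁻¹ _)
  sub-σ-connected (d , c₄) = here

  -- The vertex at which a dart of T(5) starts, recorded only as "an original vertex", "a
  -- centre", or the dividing point nearest the start of a named dart of T.  Each tile of
  -- T(5) has exactly one corner of each of the first two kinds, so this suffices to tell
  -- its five corners apart.
  data Kind : Set where
    original centre : Kind
    dividing        : Fin (n T) → Kind

  kind : Fin (n T) × Fin 5 → Kind
  kind (d , c₀) = original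
  kind (d , c₁) = dividing d
  kind (d , c₂) = dividing (a T d)
  kind (d , c₃) = centre
  kind (d , c₄) = dividing d

  dividing-injective : ∀ {x y} → dividing x ≡ dividing y → x ≡ y
  dividing-injective refl = refl

  module _ (tT : IsTiling T) where
    open IsTiling tT
    open TilingFacts tT

    dividing-degree3 : ∀ p → Dividing (proj₂ p) → OrbitSize (sub-σ T) p 3
    dividing-degree3 (d , _) div = s≤s z≤n , returns div , moves div
      where
      returns : ∀ {c} → Dividing c → iter 3 (sub-σ T) (d , c) ≡ (d , c)
      returns dividing₁ = cong (_, c₁) (α-invol d)
      returns dividing₂ = cong (_, c₂) (α-invol d)
      returns dividing₄ = cong (_, c₄) (α-invol d)
      moves : ∀ {c} → Dividing c → ∀ j → 0 < j → j < 3 → iter j (sub-σ T) (d , c) ≢ (d , c)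
      moves dividing₁ 1 _ _ = slots-differ λ ()
      moves dividing₁ 2 _ _ = slots-differ λ ()
      moves dividing₂ 1 _ _ = slots-differ λ ()
      moves dividing₂ 2 _ _ = slots-differ λ ()
      moves dividing₄ 1 _ _ = slots-differ λ ()
      moves dividing₄ 2 _ _ = slots-differ λ ()
      moves _ (suc (suc (suc _))) _ (s≤s (s≤s (s≤s ())))

    kind-σ : ∀ p → kind (sub-σ T p) ≡ kind p
    kind-σ (d , c₀) = refl
    kind-σ (d , c₁) = cong dividing (α-invol d)
    kind-σ (d , c₂) = refl
    kind-σ (d , c₃) = refl
    kind-σ (d , c₄) = refl

    kind-apart₁ : ∀ p → kind p ≢ kind (sub-φ p)
    kind-apart₁ (d , c₀) ()
    kind-apart₁ (d , c₁) e = α-nofix d (sym (trans (dividing-injective e) (α-invol (a T d))))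
    kind-apart₁ (d , c₂) ()
    kind-apart₁ (d , c₃) ()
    kind-apart₁ (d , c₄) ()

    kind-apart₂ : ∀ p → kind p ≢ kind (sub-φ (sub-φ p))
    kind-apart₂ (d , c₀) ()
    kind-apart₂ (d , c₁) ()
    kind-apart₂ (d , c₂) e = σ-no-fixed (a T d) (sym (trans (dividing-injective e) (α-invol (φ T d))))
    kind-apart₂ (d , c₃) ()
    kind-apart₂ (d , c₄) e = φ-no-fixed (φ⁻¹ T d) (trans (φ-φ⁻¹ d) (dividing-injective e))

module FromSubdivision (M T : Map) (tT : IsTiling T) (pent : Pentagonal M)
  (f : Fin (n M) ↔ (Fin (n T) × Fin 5))
  (F-α : ∀ x → Inverse.to f (a M x) ≡ sub-α T (Inverse.to f x))
  (F-σ : ∀ x → Inverse.to f (s M x) ≡ sub-σ T (Inverse.to f x)) where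

  open Subdivision T

  F : Fin (n M) → Fin (n T) × Fin 5
  F = Inverse.to f

  F-injective : ∀ {x y} → F x ≡ F y → x ≡ y
  F-injective {x} {y} e = trans (sym (Inverse.strictlyInverseʳ f x))
    (trans (cong (Inverse.from f) e) (Inverse.strictlyInverseʳ f y))

  F-φ : ∀ x → F (φ M x) ≡ sub-φ (F x)
  F-φ x = trans (F-σ (a M x)) (cong (sub-σ T) (F-α x))

  φ⁵ : ∀ x → iter 5 (φ M) x ≡ x
  φ⁵ x = proj₁ (proj₂ (pent x))

  labelling : Fin (n M) → Maybe Label
  labelling x = slot-label (proj₂ (F x))

  labelling-σ : ∀ x → labelling (s M x) ≡ labelling x
  labelling-σ x = trans (cong (λ p → slot-label (proj₂ p)) (F-σ x)) (slot-label-σ (F x))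

  slot-along : ∀ j x → proj₂ (F (iter j (φ M) x)) ≡ iter j next-slot (proj₂ (F x))
  slot-along j x =
    trans (cong proj₂ (iter-conj F {G = sub-φ} F-φ j x))
          (iter-conj proj₂ {G = next-slot} sub-φ-slot j (F x))

  unlabelled-three : ∀ x → Dividing (proj₂ (F x)) → Three M labelling x
  unlabelled-three x div =
    dividing-unlabelled div , orbitSize-from F F-injective F-σ (dividing-degree3 tT (F x) div)

  pattern-in-every-tile : ∀ x → ∃[ k ] Pattern M labelling (iter k (φ M) x)
  pattern-in-every-tile x =
    k , cong slot-label (slot 0) , three 1 dividing₄ , cong slot-label (slot 2) ,
    three 3 dividing₁ , three 4 dividing₂
    where
    k = steps-to-c₀ (proj₂ (F x))
    y = iter k (φ M) x
    slot : ∀ j → proj₂ (F (iter j (φ M) y)) ≡ iter j next-slot c₀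
    slot j = trans (slot-along j y)
      (cong (iter j next-slot) (trans (slot-along k x) (steps-to-c₀-spec (proj₂ (F x)))))
    three : ∀ j → Dividing (iter j next-slot c₀) → Three M labelling (iter j (φ M) y)
    three j div = unlabelled-three _ (subst Dividing (sym (slot j)) div)

  good-labelling : GoodLabelling M labelling
  good-labelling = labelling-σ , pattern-in-every-tile

  key : Fin (n M) → Kind
  key x = kind (F x)

  key-σ : ∀ x → key (s M x) ≡ key x
  key-σ x = trans (cong kind (F-σ x)) (kind-σ tT (F x))

  key-apart₁ : ∀ x → key x ≢ key (φ M x)
  key-apart₁ x e = kind-apart₁ tT (F x) (trans e (cong kind (F-φ x)))

  key-apart₂ : ∀ x → key x ≢ key (φ M (φ M x))
  key-apart₂ x e = kind-apart₂ tT (F x) (trans e (cong kind (iter-conj F {G = sub-φ} F-φ 2 x)))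

  -- Two corners of one tile at the same vertex would have the same key.
  nondegenerate : NonDegenerate M
  nondegenerate x k size i j i<j j<k (m , same-vertex) =
    separated-on-period5 (φ M) key φ⁵ key-apart₁ key-apart₂ x i j i<j j<5
      (trans (sym (iter-invariant key key-σ m _)) (cong key same-vertex))
    where
    j<5 : j < 5
    j<5 = subst (j <_) (orbitSize-unique size (pent x)) j<k

module Reconstruction (M : Map) (tM : IsTiling M) (pent : Pentagonal M)
  (ℓ : Fin (n M) → Maybe Label) (good : GoodLabelling M ℓ) where

  open MapFacts M
  open IsTiling tM

  φⁿ : ℕ → Fin (n M) → Fin (n M)
  φⁿ k = iter k (φ M)

  φ⁵ : ∀ x → φⁿ 5 x ≡ x
  φ⁵ x = proj₁ (proj₂ (pent x))

  ℓ-σ : ∀ x → ℓ (s M x) ≡ ℓ x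
  ℓ-σ = proj₁ good

  ℓ-φ : ∀ x → ℓ (φ M x) ≡ ℓ (a M x)
  ℓ-φ x = ℓ-σ (a M x)

  a-injective : ∀ {x y} → a M x ≡ a M y → x ≡ y
  a-injective {x} {y} e = trans (sym (α-invol x)) (trans (cong (a M) e) (α-invol y))

  three-returns : ∀ {x} → Three M ℓ x → s M (s M (s M x)) ≡ x
  three-returns (_ , _ , s³ , _) = s³

  record Position (x : Fin (n M)) : Set where
    constructor position
    field
      start   : Fin (n M)
      reads   : Pattern M ℓ start
      index   : Fin 5
      reaches : φⁿ (toℕ index) start ≡ x

  undo : ∀ k x → Σ (Fin 5) λ m → φⁿ (toℕ m) (φⁿ k x) ≡ x
  undo zero    x = c₀ , refl
  undo (suc k) x with undo k x
  ... | zero  , φᵏx≡x = c₄ , trans (cong (λ z → φⁿ 4 (φ M z)) φᵏx≡x) (φ⁵ x)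
  ... | suc m , e = inject₁ m ,
    trans (cong (λ t → φⁿ t (φ M (φⁿ k x))) (toℕ-inject₁ m))
          (trans (sym (iter-suc-inner (φ M) (toℕ m) _)) e)

  position-of : ∀ x → Position x
  position-of x with proj₂ good x
  ... | k , pat with undo k x
  ... | m , e = position (φⁿ k x) pat m e

  signature : Fin 5 → Maybe Label × Maybe Label
  signature c₀ = just ● , nothing
  signature c₁ = nothing , just ○
  signature c₂ = just ○ , nothing
  signature c₃ = nothing , nothing
  signature c₄ = nothing , just ●

  decode : Maybe Label × Maybe Label → Fin 5
  decode (just ● , _)       = c₀
  decode (just ○ , _)       = c₂
  decode (nothing , just ●) = c₄
  decode (nothing , just ○) = c₁
  decode (nothing , nothing) = c₃

  decode-signature : ∀ m → decode (signature m) ≡ m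
  decode-signature c₀ = refl
  decode-signature c₁ = refl
  decode-signature c₂ = refl
  decode-signature c₃ = refl
  decode-signature c₄ = refl

  signature-at : ∀ {r} → Pattern M ℓ r → ∀ m →
    (ℓ (φⁿ (toℕ m) r) , ℓ (φ M (φⁿ (toℕ m) r))) ≡ signature m
  signature-at (p₀ , p₁ , p₂ , p₃ , p₄) c₀ = cong₂ _,_ p₀ (proj₁ p₁)
  signature-at (p₀ , p₁ , p₂ , p₃ , p₄) c₁ = cong₂ _,_ (proj₁ p₁) p₂
  signature-at (p₀ , p₁ , p₂ , p₃ , p₄) c₂ = cong₂ _,_ p₂ (proj₁ p₃)
  signature-at (p₀ , p₁ , p₂ , p₃ , p₄) c₃ = cong₂ _,_ (proj₁ p₃) (proj₁ p₄)
  signature-at {r} (p₀ , p₁ , p₂ , p₃ , p₄) c₄ =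
    cong₂ _,_ (proj₁ p₄) (trans (cong ℓ (φ⁵ r)) p₀)

  indexOf : Fin (n M) → Fin 5
  indexOf x = decode (ℓ x , ℓ (φ M x))

  index-by-labels : ∀ {x} (P : Position x) → Position.index P ≡ indexOf x
  index-by-labels (position r pat m refl) =
    trans (sym (decode-signature m)) (cong decode (sym (signature-at pat m)))

  starts-agree : ∀ {x} (P Q : Position x) → Position.start P ≡ Position.start Q
  starts-agree P@(position r _ m e) Q@(position r′ _ m′ e′)
    with trans (index-by-labels P) (sym (index-by-labels Q))
  ... | refl = iter-injective (φ M) (φ⁻¹ M) φ⁻¹-φ (toℕ m) (trans e (sym e′))

  startOf : Fin (n M) → Fin (n M)
  startOf x = Position.start (position-of x)

  start-pattern : ∀ x → Pattern M ℓ (startOf x)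
  start-pattern x = Position.reads (position-of x)

  start-reaches : ∀ x → φⁿ (toℕ (indexOf x)) (startOf x) ≡ x
  start-reaches x = subst (λ m → φⁿ (toℕ m) (startOf x) ≡ x)
    (index-by-labels (position-of x)) (Position.reaches (position-of x))

  located : ∀ x {u v} → ℓ x ≡ u → ℓ (φ M x) ≡ v → φⁿ (toℕ (decode (u , v))) (startOf x) ≡ x
  located x refl refl = start-reaches x

  startOf-at : ∀ {r x} m → Pattern M ℓ r → φⁿ (toℕ m) r ≡ x → startOf x ≡ r
  startOf-at m pat e = starts-agree (position-of _) (position _ pat m e)

  indexOf-at : ∀ {r x} m → Pattern M ℓ r → φⁿ (toℕ m) r ≡ x → indexOf x ≡ m
  indexOf-at m pat e = sym (index-by-labels (position _ pat m e))

  -- The ●-darts are exactly the starts of tiles; they will be the darts of T.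
  Black : Fin (n M) → Set
  Black d = ℓ d ≡ just ●

  black? : ∀ x → Dec (Black x)
  black? x with ℓ x
  ... | just ● = yes refl
  ... | just ○ = no λ ()
  ... | nothing = no λ ()

  black-start : ∀ {d} → Black d → startOf d ≡ d
  black-start {d} b = located d b refl

  black-pattern : ∀ {d} → Black d → Pattern M ℓ d
  black-pattern b = subst (Pattern M ℓ) (black-start b) (start-pattern _)

  start-black : ∀ x → Black (startOf x)
  start-black x = proj₁ (start-pattern x)

  black-σ : ∀ {d} → Black d → Black (s M d)
  black-σ {d} b = trans (ℓ-σ d) b

  black-σ⁻¹ : ∀ {d} → Black d → Black (σ M ⟨$⟩ˡ d)
  black-σ⁻¹ {d} b = trans (sym (ℓ-σ _)) (trans (cong ℓ (s-s⁻¹ d)) b)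

  previous : Fin (n M) → Fin (n M)
  previous r = startOf (a M (φⁿ 2 r))

  previous-spec : ∀ {r} → Pattern M ℓ r → φ M (previous r) ≡ a M (φⁿ 2 r)
  previous-spec {r} (_ , _ , p₂ , p₃ , _) =
    located (a M (φⁿ 2 r)) (trans (sym (ℓ-σ _)) (proj₁ p₃))
                           (trans (ℓ-φ _) (trans (cong ℓ (α-invol _)) p₂))

  -- Coordinates of the darts of M as darts (d , c) of T(5), d ●-dart: position m of the
  -- tile of r corresponds to the dart listed below (compare with the slot order 0,4,3,1,2).
  coordFrom : Fin (n M) → Fin 5 → Fin (n M) × Fin 5
  coordFrom r c₀ = r , c₀
  coordFrom r c₁ = r , c₄
  coordFrom r c₂ = previous r , c₃
  coordFrom r c₃ = previous r , c₁
  coordFrom r c₄ = previous r , c₂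

  coord : Fin (n M) → Fin (n M) × Fin 5
  coord x = coordFrom (startOf x) (indexOf x)

  dartAt : Fin (n M) × Fin 5 → Fin (n M)
  dartAt (d , c₀) = d
  dartAt (d , c₁) = s M (φ M d)
  dartAt (d , c₂) = φ M (s M (φ M d))
  dartAt (d , c₃) = a M (φ M d)
  dartAt (d , c₄) = φ M d

  coord-black : ∀ x → Black (proj₁ (coord x))
  coord-black x = from-start (indexOf x)
    where
    from-start : ∀ m → Black (proj₁ (coordFrom (startOf x) m))
    from-start c₀ = start-black x
    from-start c₁ = start-black x
    from-start c₂ = start-black _
    from-start c₃ = start-black _
    from-start c₄ = start-black _

  dartAt-coord : ∀ x → dartAt (coord x) ≡ x
  dartAt-coord x = trans (from-pattern (start-pattern x) (indexOf x)) (start-reaches x)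
    where
    from-pattern : ∀ {r} → Pattern M ℓ r → ∀ m → dartAt (coordFrom r m) ≡ φⁿ (toℕ m) r
    from-pattern pat c₀ = refl
    from-pattern pat c₁ = refl
    from-pattern pat c₂ = trans (cong (a M) (previous-spec pat)) (α-invol _)
    from-pattern pat c₃ = cong (s M) (previous-spec pat)
    from-pattern pat c₄ = cong (λ z → φ M (s M z)) (previous-spec pat)

  coord-at : ∀ {r x} m → Pattern M ℓ r → φⁿ (toℕ m) r ≡ x → coord x ≡ coordFrom r m
  coord-at m pat e = cong₂ coordFrom (startOf-at m pat e) (indexOf-at m pat e)

  coord-dartAt : ∀ {d} → Black d → ∀ c → coord (dartAt (d , c)) ≡ (d , c)
  coord-dartAt {d} b = at
    where
    pd : Pattern M ℓ d
    pd = black-pattern b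
    -- the ○-corner dart of the tile across the edge at φ d
    y = a M (φ M d)
    r = startOf y
    ℓ-φd : ℓ (φ M d) ≡ nothing
    ℓ-φd = proj₁ (proj₁ (proj₂ pd))
    ℓ-φ²d : ℓ (φⁿ 2 d) ≡ just ○
    ℓ-φ²d = proj₁ (proj₂ (proj₂ pd))
    y-at-2 : φⁿ 2 r ≡ y
    y-at-2 = located y (trans (sym (ℓ-σ y)) ℓ-φ²d) (trans (ℓ-φ y) (trans (cong ℓ (α-invol _)) ℓ-φd))
    y-at-3 : φⁿ 3 r ≡ s M (φ M d)
    y-at-3 = trans (cong (φ M) y-at-2) (cong (s M) (α-invol _))
    previous-r : previous r ≡ d
    previous-r = trans (cong (λ z → startOf (a M z)) y-at-2)
                       (trans (cong startOf (α-invol _)) (startOf-at c₁ pd refl))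
    at : ∀ c → coord (dartAt (d , c)) ≡ (d , c)
    at c₀ = coord-at c₀ pd refl
    at c₁ = trans (coord-at c₃ (start-pattern y) y-at-3) (cong (_, c₁) previous-r)
    at c₂ = trans (coord-at c₄ (start-pattern y) (cong (φ M) y-at-3)) (cong (_, c₂) previous-r)
    at c₃ = trans (coord-at c₂ (start-pattern y) y-at-2) (cong (_, c₃) previous-r)
    at c₄ = coord-at c₁ pd refl

  -- The edge involution of T: the ●-dart on the other side of the edge of d.
  partner : Fin (n M) → Fin (n M)
  partner d = previous (s M d)

  partner-black : ∀ d → Black (partner d)
  partner-black d = start-black _

  -- a d is the last dart of the tile starting at s d, since φ (a d) = s d.
  reverse-last : ∀ d → φⁿ 4 (s M d) ≡ a M d
  reverse-last d = φ-injective (trans (φ⁵ (s M d)) (cong (s M) (sym (α-invol d))))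

  reverse-degree3 : ∀ {d} → Black d → s M (s M (s M (a M d))) ≡ a M d
  reverse-degree3 {d} b = subst (λ z → s M (s M (s M z)) ≡ z) (reverse-last d) (three-returns p₄)
    where
    p₄ : Three M ℓ (φⁿ 4 (s M d))
    p₄ = proj₂ (proj₂ (proj₂ (proj₂ (black-pattern (black-σ b)))))

  -- The local identities saying that dartAt intertwines a and s with T(5).
  module _ {d} (b : Black d) where
    α₀ : dartAt (partner d , c₂) ≡ a M (dartAt (d , c₀))
    α₀ = trans (cong (λ z → φ M (s M z)) (previous-spec (black-pattern (black-σ b)))) (reverse-last d)

    σ₁ : dartAt (partner d , c₂) ≡ s M (dartAt (d , c₁))
    σ₁ = trans α₀ (sym (reverse-degree3 b))

    α₁ : dartAt (partner d , c₁) ≡ a M (dartAt (d , c₁))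
    α₁ = trans (sym (α-invol _)) (cong (a M) (s-injective σ₁))

    across : dartAt (d , c₂) ≡ a M (partner d)
    across = trans (cong (s M) (sym α₁)) (reverse-degree3 (partner-black d))

    α₂ : dartAt (partner d , c₀) ≡ a M (dartAt (d , c₂))
    α₂ = trans (sym (α-invol _)) (cong (a M) (sym across))

    σ₂ : dartAt (partner d , c₄) ≡ s M (dartAt (d , c₂))
    σ₂ = cong (s M) (sym across)

    σ₃ : dartAt (partner (σ M ⟨$⟩ˡ d) , c₃) ≡ s M (dartAt (d , c₃))
    σ₃ = trans (cong (λ z → a M (φ M (previous z))) (s-s⁻¹ d))
               (trans (cong (a M) (previous-spec (black-pattern b))) (α-invol _))

  partner-involutive : ∀ {d} → Black d → partner (partner d) ≡ d
  partner-involutive {d} b = a-injective (trans (sym (across (partner-black d))) (α₀ b))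

  -- The tiling T: its darts enumerate the ●-darts.
  blacks : Enumeration Black
  blacks = enumerate (n M) Black black?

  open Enumeration blacks

  aT sT sT⁻¹ : Fin size → Fin size
  aT i = index (partner (element i)) (partner-black _)
  sT i = index (s M (element i)) (black-σ (element∈ i))
  sT⁻¹ i = index (σ M ⟨$⟩ˡ element i) (black-σ⁻¹ (element∈ i))

  aT-involutive : ∀ i → aT (aT i) ≡ i
  aT-involutive i = element-injective (trans (element-index _ _)
    (trans (cong partner (element-index _ _)) (partner-involutive (element∈ i))))

  sT-sT⁻¹ : ∀ i → sT (sT⁻¹ i) ≡ i
  sT-sT⁻¹ i = element-injective
    (trans (element-index _ _) (trans (cong (s M) (element-index _ _)) (s-s⁻¹ _)))

  sT⁻¹-sT : ∀ i → sT⁻¹ (sT i) ≡ i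
  sT⁻¹-sT i = element-injective
    (trans (element-index _ _) (trans (cong (σ M ⟨$⟩ˡ_) (element-index _ _)) (s⁻¹-s _)))

  T : Map
  T = record
    { n = size
    ; α = mk↔ₛ′ aT aT aT-involutive aT-involutive
    ; σ = mk↔ₛ′ sT sT⁻¹ sT-sT⁻¹ sT⁻¹-sT
    }

  open Subdivision T using (original-degree; centre-degree; sub-α-connected; sub-σ-connected)

  G : Fin size × Fin 5 → Fin (n M)
  G (i , c) = dartAt (element i , c)

  F : Fin (n M) → Fin size × Fin 5
  F x = index (proj₁ (coord x)) (coord-black x) , proj₂ (coord x)

  G-F : ∀ x → G (F x) ≡ x
  G-F x = trans (cong (λ d → dartAt (d , proj₂ (coord x))) (element-index _ _)) (dartAt-coord x)

  G-injective : ∀ {p q} → G p ≡ G q → p ≡ q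
  G-injective {i , c} {j , c′} e = cong₂ _,_ (element-injective (cong proj₁ same)) (cong proj₂ same)
    where
    same : (element i , c) ≡ (element j , c′)
    same = trans (sym (coord-dartAt (element∈ i) c))
                 (trans (cong coord e) (coord-dartAt (element∈ j) c′))

  F-G : ∀ p → F (G p) ≡ p
  F-G p = G-injective (G-F (G p))

  G-partner : ∀ i c → G (aT i , c) ≡ dartAt (partner (element i) , c)
  G-partner i c = cong (λ d → dartAt (d , c)) (element-index _ _)

  G-α : ∀ p → G (sub-α T p) ≡ a M (G p)
  G-α (i , c₀) = trans (G-partner i c₂) (α₀ (element∈ i))
  G-α (i , c₁) = trans (G-partner i c₁) (α₁ (element∈ i))
  G-α (i , c₂) = trans (G-partner i c₀) (α₂ (element∈ i))
  G-α (i , c₃) = sym (α-invol _)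
  G-α (i , c₄) = refl

  G-σ : ∀ p → G (sub-σ T p) ≡ s M (G p)
  G-σ (i , c₀) = element-index _ _
  G-σ (i , c₁) = trans (G-partner i c₂) (σ₁ (element∈ i))
  G-σ (i , c₂) = trans (G-partner i c₄) (σ₂ (element∈ i))
  G-σ (i , c₃) = trans (G-partner (sT⁻¹ i) c₃)
    (trans (cong (λ d → dartAt (partner d , c₃)) (element-index _ _)) (σ₃ (element∈ i)))
  G-σ (i , c₄) = refl

  F-intertwines : ∀ {h : Fin (n M) → Fin (n M)} {R : Fin size × Fin 5 → Fin size × Fin 5} →
    (∀ p → G (R p) ≡ h (G p)) → ∀ x → F (h x) ≡ R (F x)
  F-intertwines {h} e x = G-injective (trans (G-F (h x)) (sym (trans (e (F x)) (cong h (G-F x)))))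

  F-α : ∀ x → F (a M x) ≡ sub-α T (F x)
  F-α = F-intertwines {R = sub-α T} G-α

  F-σ : ∀ x → F (s M x) ≡ sub-σ T (F x)
  F-σ = F-intertwines {R = sub-σ T} G-σ

  -- T is connected: a path in M projects to a path in T.
  project : ∀ {x y} → Reach M x y → Reach T (proj₁ (F x)) (proj₁ (F y))
  project here = here
  project {x} (viaα r) = MapFacts.reach-trans T (sub-α-connected (F x))
    (subst (λ z → Reach T z _) (cong proj₁ (F-α x)) (project r))
  project {x} (viaσ r) = MapFacts.reach-trans T (sub-σ-connected (F x))
    (subst (λ z → Reach T z _) (cong proj₁ (F-σ x)) (project r))

  project-G : ∀ i → proj₁ (F (G (i , c₀))) ≡ i
  project-G i = cong proj₁ (F-G (i , c₀))

  G-degree : ∀ {p k} → OrbitSize (sub-σ T) p k → OrbitSize (s M) (G p) k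
  G-degree = orbitSize-to G G-injective G-σ

  -- Vertices of T are original vertices of T(5) and tiles of T are centres, all of degree ≥ 3
  -- in M; an edge of T fixed by a would give a fixed dart G (i , 1) of a in M.
  T-tiling : IsTiling T
  T-tiling = record
    { α-invol   = aT-involutive
    ; α-nofix   = λ i aTi≡i → α-nofix (G (i , c₁))
                    (sym (trans (cong (λ j → G (j , c₁)) (sym aTi≡i)) (G-α (i , c₁))))
    ; inhabited = proj₁ (F inhabited)
    ; connected = λ i j → subst₂ (Reach T) (project-G i) (project-G j) (project (connected _ _))
    ; degree≥3  = λ i k os → degree≥3 (G (i , c₀)) k (G-degree (original-degree os))
    ; tile≥3    = λ i k os → degree≥3 (G (i , c₃)) k (G-degree (centre-degree os))
    }

  reconstruction : IsPentSubdivision M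
  reconstruction = T , T-tiling , mk↔ₛ′ F G F-G G-F , F-α , F-σ

-- Theorem 3.3.

theorem3p3 : (M : Map) → IsTiling M → Pentagonal M →
    (IsPentSubdivision M ⇔ (NonDegenerate M × ∃[ ℓ ] GoodLabelling M ℓ))
theorem3p3 M tM pent = mk⇔ necessary sufficient
  where
  necessary : IsPentSubdivision M → NonDegenerate M × ∃[ ℓ ] GoodLabelling M ℓ
  necessary (T , tT , f , F-α , F-σ) = nondegenerate , labelling , good-labelling
    where open FromSubdivision M T tT pent f F-α F-σ

  sufficient : NonDegenerate M × ∃[ ℓ ] GoodLabelling M ℓ → IsPentSubdivision M
  sufficient (_ , ℓ , good) = Reconstruction.reconstruction M tM pent ℓ good
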